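{- Let $B=5$, let $\tilde p<0$ be an integer and $\tilde q$ a positive integer with $\tilde q\geqslant 3600\sqrt[3]{|\tilde p|}$. Let $F_1=B^{2}\tilde q^{6}+2B\tilde q^{4}-2B\tilde p\tilde q^{3}-2\tilde q^{2}-2\tilde p\tilde q+\tilde p^{2}+\frac5B-\frac{20}{B^{2}\tilde q^{2}}$. Then there is no integer $t$ with $F_1+\frac{10\tilde p}{B^{2}\tilde q^{3}}<t<F_1$. -}

module Defs where

open import Data.Nat as ℕ using (ℕ; zero; suc)
open import Data.Integer as ℤ using (ℤ; +_)
open import Data.Rational as ℚ using (ℚ; _+_; _-_; _*_; _/_)

-- 1/n as a rational, with the (irrelevant) convention 1/0 = 0.
-- Only ever applied to positive n below.
inv : ℕ → ℚ
inv zero = ℚ.0ℚ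
inv (suc n) = (+ 1) / suc n

ι : ℤ → ℚ
ι z = z / 1

B : ℚ
B = ι (+ 5)

F₁ : ℤ → ℕ → ℚ
F₁ p q =
  B * B * Q ^6 + ι (+ 2) * B * Q ^4 - ι (+ 2) * B * P * Q ^3
  - ι (+ 2) * Q * Q - ι (+ 2) * P * Q + P * P
  + ι (+ 5) * inv 5
  - ι (+ 20) * inv (25 ℕ.* (q ℕ.* q))
  where
  P = ι p
  Q = ι (+ q)
  _^6 : ℚ → ℚ
  x ^6 = x * x * x * x * x * x
  _^4 : ℚ → ℚ
  x ^4 = x * x * x * x
  _^3 : ℚ → ℚ
  x ^3 = x * x * x

lowerBound : ℤ → ℕ → ℚ
lowerBound p q = F₁ p q + ι (+ 10) * ι p * inv (25 ℕ.* (q ℕ.* q ℕ.* q))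

{-# OPTIONS --safe #-}
module Submission where

open import Defs
open import Data.Nat as ℕ using (ℕ; _^_; zero; suc)
open import Data.Integer as ℤ using (ℤ; ∣_∣; +_; -[1+_])
open import Data.Rational as ℚ using (ℚ; _+_; _-_; _*_; -_; 1ℚ; 0ℚ; _≤_; _<_)
open import Data.Product using (_×_; _,_)
open import Relation.Nullary using (¬_)
open import Relation.Nullary.Decidable using (toWitness)
open import Relation.Binary.PropositionalEquality
import Data.Rational.Properties as ℚP
import Data.Rational.Unnormalised as ℚᵘ
import Data.Rational.Unnormalised.Properties as ℚᵘP
import Data.Integer.Properties as ℤP
import Data.Nat.Properties as ℕP
open import Data.Rational.Solver using (module +-*-Solver)
open +-*-Solver using (solve; _:+_; _:-_; _:*_; _:=_)

-- F₁ = M − 20/(25q²) for the integer M = B²q⁶ + … + p² + 1, and the lower bound is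
-- M − (20q − 10p)/(25q³). As p < 0 and 10|p| ≤ 3600³|p| ≤ q³, we get
-- 20q − 10p ≤ 21q³ ≤ 25q³, so both bounds lie in [M − 1, M], whose interior
-- contains no integer.

toℚᵘ-ι : ∀ z → ℚ.toℚᵘ (ι z) ℚᵘ.≃ ℚᵘ.mkℚᵘ z 0
toℚᵘ-ι z = ℚP.toℚᵘ-fromℚᵘ (ℚᵘ.mkℚᵘ z 0)

ι≡-from-≃ᵘ : ∀ z {r} → ℚᵘ.mkℚᵘ z 0 ℚᵘ.≃ ℚ.toℚᵘ r → ι z ≡ r
ι≡-from-≃ᵘ z e = ℚP.toℚᵘ-injective (ℚᵘP.≃-trans (toℚᵘ-ι z) e)

ι-homo-+ : ∀ x y → ι (x ℤ.+ y) ≡ ι x + ι y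
ι-homo-+ x y = ι≡-from-≃ᵘ (x ℤ.+ y) (ℚᵘP.≃-sym (ℚᵘP.≃-trans (ℚP.toℚᵘ-homo-+ (ι x) (ι y))
  (ℚᵘP.≃-trans (ℚᵘP.+-cong (toℚᵘ-ι x) (toℚᵘ-ι y))
    (ℚᵘ.*≡* (cong (ℤ._* + 1) (cong₂ ℤ._+_ (ℤP.*-identityʳ x) (ℤP.*-identityʳ y)))))))

ι-homo-* : ∀ x y → ι (x ℤ.* y) ≡ ι x * ι y
ι-homo-* x y = ι≡-from-≃ᵘ (x ℤ.* y) (ℚᵘP.≃-sym (ℚᵘP.≃-trans (ℚP.toℚᵘ-homo-* (ι x) (ι y))
  (ℚᵘP.*-cong (toℚᵘ-ι x) (toℚᵘ-ι y))))

ι-homo‿- : ∀ x → ι (ℤ.- x) ≡ - ι x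
ι-homo‿- x = ι≡-from-≃ᵘ (ℤ.- x)
  (ℚᵘP.≃-sym (ℚᵘP.≃-trans (ℚP.toℚᵘ-homo‿- (ι x)) (ℚᵘP.-‿cong (toℚᵘ-ι x))))

ι-homo-- : ∀ x y → ι (x ℤ.- y) ≡ ι x - ι y
ι-homo-- x y = trans (ι-homo-+ x (ℤ.- y)) (cong (λ r → ι x + r) (ι-homo‿- y))

ι-mono-≤ : ∀ {x y} → x ℤ.≤ y → ι x ≤ ι y
ι-mono-≤ {x} {y} x≤y = ℚP.toℚᵘ-cancel-≤
  (ℚᵘP.≤-respˡ-≃ (ℚᵘP.≃-sym (toℚᵘ-ι x)) (ℚᵘP.≤-respʳ-≃ (ℚᵘP.≃-sym (toℚᵘ-ι y))
    (ℚᵘ.*≤* (subst₂ ℤ._≤_ (sym (ℤP.*-identityʳ x)) (sym (ℤP.*-identityʳ y)) x≤y))))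

ι-cancel-< : ∀ {x y} → ι x < ι y → x ℤ.< y
ι-cancel-< {x} {y} ιx<ιy
  with ℚᵘP.<-respˡ-≃ (toℚᵘ-ι x) (ℚᵘP.<-respʳ-≃ (toℚᵘ-ι y) (ℚP.toℚᵘ-mono-< ιx<ιy))
... | ℚᵘ.*<* x*1<y*1 = subst₂ ℤ._<_ (ℤP.*-identityʳ x) (ℤP.*-identityʳ y) x*1<y*1

toℚᵘ-inv : ∀ n .{{_ : ℕ.NonZero n}} → ℚ.toℚᵘ (inv n) ℚᵘ.≃ ℚᵘ.1/ ℚᵘ.mkℚᵘ (+ n) 0
toℚᵘ-inv (suc m) = ℚP.toℚᵘ-fromℚᵘ (ℚᵘ.mkℚᵘ (+ 1) m)

ι-*-inv : ∀ n .{{_ : ℕ.NonZero n}} → ι (+ n) * inv n ≡ 1ℚ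
ι-*-inv n@(suc _) = ℚP.toℚᵘ-injective (ℚᵘP.≃-trans (ℚP.toℚᵘ-homo-* (ι (+ n)) (inv n))
  (ℚᵘP.≃-trans (ℚᵘP.*-cong (toℚᵘ-ι (+ n)) (toℚᵘ-inv n)) (ℚᵘP.*-inverseʳ (ℚᵘ.mkℚᵘ (+ n) 0))))

inv-nonNeg : ∀ n → ℚ.NonNegative (inv n)
inv-nonNeg zero    = _
inv-nonNeg (suc m) = ℚP.normalize-nonNeg 1 (suc m)

inv≡ι*inv[*] : ∀ m n .{{_ : ℕ.NonZero m}} .{{_ : ℕ.NonZero n}} →
               inv m ≡ ι (+ n) * inv (m ℕ.* n)
inv≡ι*inv[*] m@(suc _) n@(suc _) = begin
  inv m                                        ≡⟨ ℚP.*-identityʳ (inv m) ⟨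
  inv m * 1ℚ                                   ≡⟨ cong (inv m *_) (ι-*-inv (m ℕ.* n)) ⟨
  inv m * (ι (+ (m ℕ.* n)) * inv (m ℕ.* n))    ≡⟨ cong (λ r → inv m * (r * inv (m ℕ.* n))) ι[m*n] ⟩
  inv m * (ι (+ m) * ι (+ n) * inv (m ℕ.* n))  ≡⟨ solve 4 (λ u x y v → u :* (x :* y :* v) := (x :* u) :* (y :* v))
                                                    refl (inv m) (ι (+ m)) (ι (+ n)) (inv (m ℕ.* n)) ⟩
  ι (+ m) * inv m * (ι (+ n) * inv (m ℕ.* n))  ≡⟨ cong (_* (ι (+ n) * inv (m ℕ.* n))) (ι-*-inv m) ⟩
  1ℚ * (ι (+ n) * inv (m ℕ.* n))               ≡⟨ ℚP.*-identityˡ _ ⟩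
  ι (+ n) * inv (m ℕ.* n)                      ∎
  where
  open ≡-Reasoning
  ι[m*n] : ι (+ (m ℕ.* n)) ≡ ι (+ m) * ι (+ n)
  ι[m*n] = trans (cong ι (ℤP.pos-* m n)) (ι-homo-* (+ m) (+ n))

ι*inv≤1 : ∀ z n .{{_ : ℕ.NonZero n}} → z ℤ.≤ + n → ι z * inv n ≤ 1ℚ
ι*inv≤1 z n z≤n = subst (ι z * inv n ≤_) (ι-*-inv n)
  (ℚP.*-monoʳ-≤-nonNeg (inv n) {{inv-nonNeg n}} (ι-mono-≤ z≤n))

no-integer-strictly-between : ∀ m {x y} → ι m - 1ℚ ≤ x → y ≤ ι m →
                              ∀ t → ¬ (x < ι t × ι t < y)
no-integer-strictly-between m {x} m-1≤x y≤m t (x<t , t<y) =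
  ℤP.<-irrefl refl (ℤP.≤-<-trans t≤pred[m] pred[m]<t)
  where
  t≤pred[m] : t ℤ.≤ ℤ.pred m
  t≤pred[m] = ℤP.i<j⇒i≤pred[j] (ι-cancel-< {t} {m} (ℚP.<-≤-trans t<y y≤m))
  ι-pred : ι (ℤ.pred m) ≡ ι m - 1ℚ
  ι-pred = trans (ι-homo-+ ℤ.-1ℤ m) (ℚP.+-comm _ (ι m))
  pred[m]<t : ℤ.pred m ℤ.< t
  pred[m]<t = ι-cancel-< {ℤ.pred m} (ℚP.≤-<-trans (subst (_≤ x) (sym ι-pred) m-1≤x) x<t)

p≤q⇒r-q≤r-p : ∀ r {p q} → p ≤ q → r - q ≤ r - p
p≤q⇒r-q≤r-p r p≤q = ℚP.+-monoʳ-≤ r (ℚP.neg-antimono-≤ p≤q)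

-- ι is not a constructor, so x cannot be inferred from ι x ≡ X; indexing by x
-- lets the congruences below assemble ι (e) ≡ E along the syntax of e.
infix 4 _↦_
record _↦_ (x : ℤ) (X : ℚ) : Set where
  constructor ι≡
  field ι≡X : ι x ≡ X
open _↦_

↦-ι : ∀ x → x ↦ ι x
↦-ι x = ι≡ refl

↦-+ : ∀ {x y X Y} → x ↦ X → y ↦ Y → x ℤ.+ y ↦ X + Y
↦-+ {x} {y} (ι≡ ιx≡X) (ι≡ ιy≡Y) = ι≡ (trans (ι-homo-+ x y) (cong₂ _+_ ιx≡X ιy≡Y))

↦-- : ∀ {x y X Y} → x ↦ X → y ↦ Y → x ℤ.- y ↦ X - Y
↦-- {x} {y} (ι≡ ιx≡X) (ι≡ ιy≡Y) = ι≡ (trans (ι-homo-- x y) (cong₂ _-_ ιx≡X ιy≡Y))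

↦-* : ∀ {x y X Y} → x ↦ X → y ↦ Y → x ℤ.* y ↦ X * Y
↦-* {x} {y} (ι≡ ιx≡X) (ι≡ ιy≡Y) = ι≡ (trans (ι-homo-* x y) (cong₂ _*_ ιx≡X ιy≡Y))

integerPart : ℤ → ℕ → ℤ
integerPart p q =
  + 5 ℤ.* + 5 ℤ.* (q′ ℤ.* q′ ℤ.* q′ ℤ.* q′ ℤ.* q′ ℤ.* q′)
  ℤ.+ + 2 ℤ.* + 5 ℤ.* (q′ ℤ.* q′ ℤ.* q′ ℤ.* q′)
  ℤ.- + 2 ℤ.* + 5 ℤ.* p ℤ.* (q′ ℤ.* q′ ℤ.* q′)
  ℤ.- + 2 ℤ.* q′ ℤ.* q′ ℤ.- + 2 ℤ.* p ℤ.* q′ ℤ.+ p ℤ.* p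
  ℤ.+ + 1
  where q′ = + q

F₁≡integerPart-ε : ∀ p q → F₁ p q ≡ ι (integerPart p q) - ι (+ 20) * inv (25 ℕ.* (q ℕ.* q))
F₁≡integerPart-ε p q = cong (_- ι (+ 20) * inv (25 ℕ.* (q ℕ.* q))) (sym (ι≡X integerPart↦))
  where
  P = ι p
  Q = ι (+ q)
  integerPart↦ : integerPart p q ↦
    (B * B * (Q * Q * Q * Q * Q * Q) + ι (+ 2) * B * (Q * Q * Q * Q) - ι (+ 2) * B * P * (Q * Q * Q)
     - ι (+ 2) * Q * Q - ι (+ 2) * P * Q + P * P + ι (+ 5) * inv 5)
  integerPart↦ =
    ↦-+ (↦-+ (↦-- (↦-- (↦-- (↦-+ (↦-* (↦-* `5 `5) (↦-* (↦-* (↦-* (↦-* (↦-* `q `q) `q) `q) `q) `q))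
      (↦-* (↦-* `2 `5) (↦-* (↦-* (↦-* `q `q) `q) `q))) (↦-* (↦-* (↦-* `2 `5) `p) (↦-* (↦-* `q `q) `q)))
      (↦-* (↦-* `2 `q) `q)) (↦-* (↦-* `2 `p) `q)) (↦-* `p `p)) (ι≡ refl)
    where
    `2 = ↦-ι (+ 2)
    `5 = ↦-ι (+ 5)
    `p = ↦-ι p
    `q = ↦-ι (+ q)

lowerBound≡integerPart-δ : ∀ p q .{{_ : ℕ.NonZero q}} →
  lowerBound p q ≡ ι (integerPart p q) - ι (+ 20 ℤ.* + q ℤ.- + 10 ℤ.* p) * inv (25 ℕ.* (q ℕ.* q ℕ.* q))
lowerBound≡integerPart-δ p q@(suc _) = begin
  lowerBound p q                            ≡⟨ cong (_+ c) (F₁≡integerPart-ε p q) ⟩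
  M - ι (+ 20) * inv (25 ℕ.* (q ℕ.* q)) + c ≡⟨ cong (λ r → M - ι (+ 20) * r + c) inv[25q²]≡q*inv[25q³] ⟩
  M - ι (+ 20) * (Q * inv D) + c            ≡⟨ solve 6 (λ m t10 t20 Q′ P′ v →
                                                  m :- t20 :* (Q′ :* v) :+ t10 :* P′ :* v := m :- (t20 :* Q′ :- t10 :* P′) :* v)
                                                 refl M (ι (+ 10)) (ι (+ 20)) Q (ι p) (inv D) ⟩
  M - (ι (+ 20) * Q - ι (+ 10) * ι p) * inv D ≡⟨ cong (λ r → M - r * inv D) (sym (ι≡X δ↦)) ⟩
  M - ι (+ 20 ℤ.* + q ℤ.- + 10 ℤ.* p) * inv D ∎
  where
  open ≡-Reasoning
  M = ι (integerPart p q)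
  Q = ι (+ q)
  D = 25 ℕ.* (q ℕ.* q ℕ.* q)
  c = ι (+ 10) * ι p * inv D
  inv[25q²]≡q*inv[25q³] : inv (25 ℕ.* (q ℕ.* q)) ≡ Q * inv D
  inv[25q²]≡q*inv[25q³] = trans (inv≡ι*inv[*] (25 ℕ.* (q ℕ.* q)) q)
    (cong (λ n → Q * inv n) (ℕP.*-assoc 25 (q ℕ.* q) q))
  δ↦ : + 20 ℤ.* + q ℤ.- + 10 ℤ.* p ↦ ι (+ 20) * Q - ι (+ 10) * ι p
  δ↦ = ↦-- (↦-* (↦-ι (+ 20)) (↦-ι (+ q))) (↦-* (↦-ι (+ 10)) (↦-ι p))

20q+10n≤25q³ : ∀ q n .{{_ : ℕ.NonZero q}} → 10 ℕ.* n ℕ.≤ q ^ 3 →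
              20 ℕ.* q ℕ.+ 10 ℕ.* n ℕ.≤ 25 ℕ.* (q ℕ.* q ℕ.* q)
20q+10n≤25q³ q@(suc _) n 10n≤q³ = begin
  20 ℕ.* q ℕ.+ 10 ℕ.* n ≤⟨ ℕP.+-mono-≤ (ℕP.*-monoʳ-≤ 20 (ℕP.m≤n*m q (q ℕ.* q)))
                                       (subst (10 ℕ.* n ℕ.≤_) q^3≡q*q*q 10n≤q³) ⟩
  20 ℕ.* q³ ℕ.+ q³      ≡⟨ ℕP.+-comm (20 ℕ.* q³) q³ ⟩
  21 ℕ.* q³             ≤⟨ ℕP.*-monoˡ-≤ q³ (ℕP.m≤m+n 21 4) ⟩
  25 ℕ.* q³             ∎
  where
  open ℕP.≤-Reasoning
  q³ = q ℕ.* q ℕ.* q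
  q^3≡q*q*q : q ^ 3 ≡ q³
  q^3≡q*q*q = trans (cong (λ r → q ℕ.* (q ℕ.* r)) (ℕP.*-identityʳ q)) (sym (ℕP.*-assoc q q q))

F₁≤integerPart : ∀ p q → F₁ p q ≤ ι (integerPart p q)
F₁≤integerPart p q = subst₂ _≤_ (sym (F₁≡integerPart-ε p q)) (ℚP.+-identityʳ (ι (integerPart p q)))
  (p≤q⇒r-q≤r-p (ι (integerPart p q)) 0≤ε)
  where
  ε = ι (+ 20) * inv (25 ℕ.* (q ℕ.* q))
  0≤ε : 0ℚ ≤ ε
  0≤ε = ℚP.nonNegative⁻¹ ε
    {{ℚP.nonNeg*nonNeg⇒nonNeg (ι (+ 20)) (inv (25 ℕ.* (q ℕ.* q))) {{inv-nonNeg (25 ℕ.* (q ℕ.* q))}}}}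

integerPart-1≤lowerBound : ∀ p q .{{_ : ℕ.NonZero q}} →
  + 20 ℤ.* + q ℤ.- + 10 ℤ.* p ℤ.≤ + (25 ℕ.* (q ℕ.* q ℕ.* q)) →
  ι (integerPart p q) - 1ℚ ≤ lowerBound p q
integerPart-1≤lowerBound p q@(suc _) δ≤25q³ =
  subst (ι (integerPart p q) - 1ℚ ≤_) (sym (lowerBound≡integerPart-δ p q))
    (p≤q⇒r-q≤r-p (ι (integerPart p q)) (ι*inv≤1 _ (25 ℕ.* (q ℕ.* q ℕ.* q)) δ≤25q³))

theorem7p2 : (p : ℤ) (q : ℕ) → p ℤ.< + 0 → 1 ℕ.≤ q → 3600 ^ 3 ℕ.* ∣ p ∣ ℕ.≤ q ^ 3 →
    (t : ℤ) → ¬ ((lowerBound p q < ι t) × (ι t < F₁ p q))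
theorem7p2 (+ _)          _         (ℤ.+<+ ()) _ _
theorem7p2 p@(-[1+ _ ]) q@(suc _) _ _ 3600³∣p∣≤q³ =
  no-integer-strictly-between (integerPart p q)
    (integerPart-1≤lowerBound p q δ≤25q³) (F₁≤integerPart p q)
  where
  10∣p∣≤q³ : 10 ℕ.* ∣ p ∣ ℕ.≤ q ^ 3
  10∣p∣≤q³ = ℕP.≤-trans (ℕP.*-monoˡ-≤ ∣ p ∣ (toWitness {a? = 10 ℕ.≤? 3600 ^ 3} _)) 3600³∣p∣≤q³
  -- for these constructor forms of p and q the left side computes to + (20 q + 10 ∣ p ∣)
  δ≤25q³ : + 20 ℤ.* + q ℤ.- + 10 ℤ.* p ℤ.≤ + (25 ℕ.* (q ℕ.* q ℕ.* q))
  δ≤25q³ = ℤ.+≤+ (20q+10n≤25q³ q ∣ p ∣ 10∣p∣≤q³)
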